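{- Let $n \geq 5$ and $m \geq 1$ be integers and let $2 \leq s_2 < \dots < s_m \leq \lfloor \frac{n-1}{2} \rfloor$ be integers; put $S = (1, s_2, \dots, s_m)$. Let $C_n(S)$ be the circulant graph on vertex set $\mathbb{Z}_n$ in which $i$ and $j$ are adjacent iff $i-j \equiv \pm 1$ or $i - j \equiv \pm s_k \pmod n$ for some $2 \leq k \leq m$. Let $G = GGPG(n, m; s_2, \dots, s_m)$ be the graph with vertex set $\{u_i, v_i : i \in \mathbb{Z}_n\}$ and edge set consisting of the outer edges $u_i u_{i+1}$, the inner edges $v_i v_{i \pm s_k}$ ($2 \leq k \leq m$), and the spokes $u_i v_i$, for all $i \in \mathbb{Z}_n$ (subscripts modulo $n$). Writing $D(\cdot)$ for the diameter of a graph, $$D(C_n(S)) + 1 \leq D(GGPG(n, m; s_2, \dots, s_m)) \leq D(C_n(S)) + 2.$$ -}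

module Defs where

open import Data.Nat using (ℕ; zero; suc; _+_; _≤_; NonZero)
open import Data.Nat.DivMod using (_mod_)
open import Data.Fin using (Fin; toℕ)
open import Data.Sum using (_⊎_; inj₁; inj₂)
open import Data.Product using (Σ; ∃; _×_; _,_)
open import Relation.Binary.PropositionalEquality using (_≡_)

Graph : Set → Set₁
Graph V = V → V → Set

DiffMod : (n : ℕ) .{{_ : NonZero n}} → ℕ → Fin n → Fin n → Set
DiffMod n d x y = ((toℕ x + d) mod n ≡ y) ⊎ ((toℕ y + d) mod n ≡ x)

-- Circulant graph C_n(S) with S = (1, s_2, …, s_m);
-- the jumps s_2,…,s_m are given as t : Fin k → ℕ (k = m - 1).
Circulant : (n : ℕ) .{{_ : NonZero n}} → {k : ℕ} → (Fin k → ℕ) → Graph (Fin n)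
Circulant n t x y = DiffMod n 1 x y ⊎ Σ (Fin _) (λ j → DiffMod n (t j) x y)

-- GGPG(n, m; s_2, …, s_m): vertex inj₁ i is u_i, vertex inj₂ i is v_i.
GGPG : (n : ℕ) .{{_ : NonZero n}} → {k : ℕ} → (Fin k → ℕ) → Graph (Fin n ⊎ Fin n)
GGPG n t (inj₁ x) (inj₁ y) = DiffMod n 1 x y
GGPG n {k} t (inj₂ x) (inj₂ y) = Σ (Fin k) (λ j → DiffMod n (t j) x y)
GGPG n t (inj₁ x) (inj₂ y) = x ≡ y
GGPG n t (inj₂ x) (inj₁ y) = x ≡ y

data Walk {V : Set} (E : Graph V) : V → V → ℕ → Set where
  here : ∀ {x} → Walk E x x 0
  step : ∀ {x y z k} → E x y → Walk E y z k → Walk E x z (suc k)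

HasDiameter : {V : Set} → Graph V → ℕ → Set
HasDiameter {V} E D =
  (∀ (x y : V) → ∃ λ k → k ≤ D × Walk E x y k) ×
  ∃ λ (x : V) → ∃ λ (y : V) → ∀ k → Walk E x y k → D ≤ k

-- Both circulant jumps act on ℤ_n by translations, which commute, so any walk
-- of C_n(S) can be reordered into its ±1 steps followed by its ±s_k steps. Read on the two
-- rims of GGPG, with one spoke in between, it becomes a walk u_x ⇝ v_y that is exactly one
-- step longer; at most one more spoke reaches the other two vertex pairs, giving D + 2.
-- Conversely, forgetting the rim turns a walk of GGPG into a walk of C_n(S), and a walk from
-- u_x to v_y loses at least one spoke, giving D + 1.
module Submission where

open import Defs
open import Data.Nat using (ℕ; suc; _+_; _*_; _∸_; _/_; _%_; _≤_; _<_; z≤n; s≤s; NonZero)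
open import Data.Nat.Properties
  using (+-comm; +-assoc; +-suc; *-suc; ≤-refl; ≤-trans; n≤1+n; +-monoʳ-≤; module ≤-Reasoning)
open import Data.Nat.DivMod using (_mod_; %-distribˡ-+; m%n%n≡m%n; [m+kn]%n≡m%n; m<n⇒m%n≡m)
open import Data.Fin using (Fin; toℕ)
open import Data.Fin.Properties using (toℕ-fromℕ<; toℕ-injective; toℕ<n)
open import Data.Sum using (_⊎_; inj₁; inj₂; reduce; swap)
open import Data.Product using (Σ; ∃; _×_; _,_)
open import Function using (id)
open import Relation.Binary.PropositionalEquality
  using (_≡_; refl; sym; trans; cong; subst; module ≡-Reasoning)

module _ {V : Set} where

  _∪_ : Graph V → Graph V → Graph V
  (E ∪ F) x y = E x y ⊎ F x y

  _++ʷ_ : ∀ {E : Graph V} {x y z a b} → Walk E x y a → Walk E y z b → Walk E x z (a + b)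
  here       ++ʷ w = w
  (step e v) ++ʷ w = step e (v ++ʷ w)

  gmap : ∀ {W : Set} {E : Graph V} {F : Graph W} {f : V → W} →
         (∀ {x y} → E x y → F (f x) (f y)) → ∀ {x y k} → Walk E x y k → Walk F (f x) (f y) k
  gmap h here       = here
  gmap h (step e w) = step (h e) (gmap h w)

  Commutes : Graph V → Graph V → Set
  Commutes E F = ∀ {x y z} → F x y → E y z → ∃ λ w → E x w × F w z

  module _ {E F : Graph V} (comm : Commutes E F) where

    move-past : ∀ {x y z a} → F x y → Walk E y z a → ∃ λ w → Walk E x w a × F w z
    move-past f here = _ , here , f
    move-past f (step e w) with comm f e
    ... | _ , e′ , f′ with move-past f′ w
    ...   | _ , w′ , f″ = _ , step e′ w′ , f″

    separate : ∀ {x y k} → Walk (E ∪ F) x y k →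
               ∃ λ z → ∃ λ a → ∃ λ b → a + b ≡ k × Walk E x z a × Walk F z y b
    separate here = _ , 0 , 0 , refl , here , here
    separate (step (inj₁ e) w) with separate w
    ... | _ , a , b , a+b≡k , we , wf = _ , suc a , b , cong suc a+b≡k , step e we , wf
    separate (step (inj₂ f) w) with separate w
    ... | _ , a , b , a+b≡k , we , wf with move-past f we
    ...   | _ , we′ , f′ = _ , a , suc b , trans (+-suc a b) (cong suc a+b≡k) , we′ , step f′ wf

m*[n∸1]+m≡m*n : ∀ m n .{{_ : NonZero n}} → m * (n ∸ 1) + m ≡ m * n
m*[n∸1]+m≡m*n m (suc n-1) = trans (+-comm (m * n-1) m) (sym (*-suc m n-1))

module _ (n : ℕ) .{{_ : NonZero n}} where

  shift : ℕ → Fin n → Fin n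
  shift d x = (toℕ x + d) mod n

  toℕ-shift : ∀ d x → toℕ (shift d x) ≡ (toℕ x + d) % n
  toℕ-shift d x = toℕ-fromℕ< _

  [m%n+k]%n≡[m+k]%n : ∀ m k → (m % n + k) % n ≡ (m + k) % n
  [m%n+k]%n≡[m+k]%n m k = begin
    (m % n + k) % n           ≡⟨ %-distribˡ-+ (m % n) k n ⟩
    (m % n % n + k % n) % n   ≡⟨ cong (λ r → (r + k % n) % n) (m%n%n≡m%n m n) ⟩
    (m % n + k % n) % n       ≡⟨ %-distribˡ-+ m k n ⟨
    (m + k) % n               ∎
    where open ≡-Reasoning

  shift-shift : ∀ a b x → shift a (shift b x) ≡ shift (b + a) x
  shift-shift a b x = toℕ-injective (begin
    toℕ (shift a (shift b x))   ≡⟨ toℕ-shift a (shift b x) ⟩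
    (toℕ (shift b x) + a) % n   ≡⟨ cong (λ r → (r + a) % n) (toℕ-shift b x) ⟩
    ((toℕ x + b) % n + a) % n   ≡⟨ [m%n+k]%n≡[m+k]%n (toℕ x + b) a ⟩
    (toℕ x + b + a) % n         ≡⟨ cong (_% n) (+-assoc (toℕ x) b a) ⟩
    (toℕ x + (b + a)) % n       ≡⟨ toℕ-shift (b + a) x ⟨
    toℕ (shift (b + a) x)       ∎)
    where open ≡-Reasoning

  shift-comm : ∀ a b x → shift a (shift b x) ≡ shift b (shift a x)
  shift-comm a b x = begin
    shift a (shift b x)  ≡⟨ shift-shift a b x ⟩
    shift (b + a) x      ≡⟨ cong (λ c → shift c x) (+-comm b a) ⟩
    shift (a + b) x      ≡⟨ shift-shift b a x ⟨
    shift b (shift a x)  ∎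
    where open ≡-Reasoning

  shift-multiple : ∀ c x → shift (c * n) x ≡ x
  shift-multiple c x = toℕ-injective (begin
    toℕ (shift (c * n) x)   ≡⟨ toℕ-shift (c * n) x ⟩
    (toℕ x + c * n) % n     ≡⟨ [m+kn]%n≡m%n (toℕ x) c n ⟩
    toℕ x % n               ≡⟨ m<n⇒m%n≡m (toℕ<n x) ⟩
    toℕ x                   ∎)
    where open ≡-Reasoning

  -- Translation by −d, realised as translation by d (n − 1) ≡ −d (mod n).
  unshift : ℕ → Fin n → Fin n
  unshift d = shift (d * (n ∸ 1))

  shift-unshift : ∀ d x → shift d (unshift d x) ≡ x
  shift-unshift d x = begin
    shift d (unshift d x)      ≡⟨ shift-shift d _ x ⟩
    shift (d * (n ∸ 1) + d) x  ≡⟨ cong (λ c → shift c x) (m*[n∸1]+m≡m*n d n) ⟩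
    shift (d * n) x            ≡⟨ shift-multiple d x ⟩
    x                          ∎
    where open ≡-Reasoning

  shift-injective : ∀ d {x y} → shift d x ≡ shift d y → x ≡ y
  shift-injective d {x} {y} eq = begin
    x                      ≡⟨ shift-unshift d x ⟨
    shift d (unshift d x)  ≡⟨ shift-comm d _ x ⟩
    unshift d (shift d x)  ≡⟨ cong (unshift d) eq ⟩
    unshift d (shift d y)  ≡⟨ shift-comm _ d y ⟩
    shift d (unshift d y)  ≡⟨ shift-unshift d y ⟩
    y                      ∎
    where open ≡-Reasoning

  -- DiffMod n d x y unfolds to  shift d x ≡ y ⊎ shift d y ≡ x.
  DiffMod-commute : ∀ d₁ d₂ → Commutes (DiffMod n d₂) (DiffMod n d₁)
  DiffMod-commute d₁ d₂ {x} (inj₁ refl) (inj₁ refl) =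
    shift d₂ x , inj₁ refl , inj₁ (shift-comm d₁ d₂ x)
  DiffMod-commute d₁ d₂ {x} {z = z} (inj₁ refl) (inj₂ z→y) =
    unshift d₂ x , inj₂ (shift-unshift d₂ x) ,
    inj₁ (shift-injective d₂ (begin
      shift d₂ (shift d₁ (unshift d₂ x))  ≡⟨ shift-comm d₂ d₁ _ ⟩
      shift d₁ (shift d₂ (unshift d₂ x))  ≡⟨ cong (shift d₁) (shift-unshift d₂ x) ⟩
      shift d₁ x                          ≡⟨ sym z→y ⟩
      shift d₂ z                          ∎))
    where open ≡-Reasoning
  DiffMod-commute d₁ d₂ {x} {y} (inj₂ refl) (inj₁ refl) =
    shift d₂ x , inj₁ refl , inj₂ (shift-comm d₁ d₂ y)
  DiffMod-commute d₁ d₂ {z = z} (inj₂ refl) (inj₂ refl) =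
    unshift d₂ x , inj₂ (shift-unshift d₂ x) ,
    inj₂ (shift-injective d₂ (begin
      shift d₂ (shift d₁ z)      ≡⟨ shift-comm d₂ d₁ z ⟩
      x                          ≡⟨ shift-unshift d₂ x ⟨
      shift d₂ (unshift d₂ x)    ∎))
    where
      open ≡-Reasoning
      x = shift d₁ (shift d₂ z)

module _ (n : ℕ) .{{_ : NonZero n}} {r : ℕ} (t : Fin r → ℕ) where

  Outer : Graph (Fin n)
  Outer = DiffMod n 1

  Inner : Graph (Fin n)
  Inner x y = Σ (Fin r) λ j → DiffMod n (t j) x y

  outer-inner : Commutes Outer Inner
  outer-inner (j , f) e with DiffMod-commute n (t j) 1 f e
  ... | w , e′ , f′ = w , e′ , (j , f′)

  inner-outer : Commutes Inner Outer
  inner-outer e (j , f) with DiffMod-commute n 1 (t j) e f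
  ... | w , f′ , e′ = w , (j , f′) , e′

  u⇝v : ∀ {x y k} → Walk (Circulant n t) x y k → Walk (GGPG n t) (inj₁ x) (inj₂ y) (suc k)
  u⇝v w with separate outer-inner w
  ... | _ , a , b , a+b≡k , wo , wi =
    subst (Walk _ _ _) (trans (+-suc a b) (cong suc a+b≡k))
      (gmap {f = inj₁} id wo ++ʷ step refl (gmap {f = inj₂} id wi))

  v⇝u : ∀ {x y k} → Walk (Circulant n t) x y k → Walk (GGPG n t) (inj₂ x) (inj₁ y) (suc k)
  v⇝u w with separate inner-outer (gmap swap w)
  ... | _ , a , b , a+b≡k , wi , wo =
    subst (Walk _ _ _) (trans (+-suc a b) (cong suc a+b≡k))
      (gmap {f = inj₂} id wi ++ʷ step refl (gmap {f = inj₁} id wo))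

  lift : ∀ p q {k} → Walk (Circulant n t) (reduce p) (reduce q) k →
         ∃ λ l → l ≤ 2 + k × Walk (GGPG n t) p q l
  lift (inj₁ x) (inj₁ y) w = _ , ≤-refl , step refl (v⇝u w)
  lift (inj₁ x) (inj₂ y) w = _ , n≤1+n _ , u⇝v w
  lift (inj₂ x) (inj₁ y) w = _ , n≤1+n _ , v⇝u w
  lift (inj₂ x) (inj₂ y) w = _ , ≤-refl , step refl (u⇝v w)

  project : ∀ {p q l} → Walk (GGPG n t) p q l →
            ∃ λ k → k ≤ l × Walk (Circulant n t) (reduce p) (reduce q) k
  project here = _ , z≤n , here
  project (step {x = inj₁ _} {y = inj₁ _} e w) with project w
  ... | _ , k≤l , w′ = _ , s≤s k≤l , step (inj₁ e) w′
  project (step {x = inj₂ _} {y = inj₂ _} e w) with project w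
  ... | _ , k≤l , w′ = _ , s≤s k≤l , step (inj₂ e) w′
  project (step {x = inj₁ _} {y = inj₂ _} refl w) with project w
  ... | _ , k≤l , w′ = _ , ≤-trans k≤l (n≤1+n _) , w′
  project (step {x = inj₂ _} {y = inj₁ _} refl w) with project w
  ... | _ , k≤l , w′ = _ , ≤-trans k≤l (n≤1+n _) , w′

  project-u⇝v : ∀ {x y l} → Walk (GGPG n t) (inj₁ x) (inj₂ y) l →
                ∃ λ k → k < l × Walk (Circulant n t) x y k
  project-u⇝v (step {y = inj₁ _} e w) with project-u⇝v w
  ... | _ , k<l , w′ = _ , s≤s k<l , step (inj₁ e) w′
  project-u⇝v (step {y = inj₂ _} refl w) with project w
  ... | _ , k≤l , w′ = _ , s≤s k≤l , w′

-- The bounds hold for every n and every family of jumps.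
theorem4p2 : (n m : ℕ) .{{_ : NonZero n}} → 5 ≤ n → 1 ≤ m →
    (t : Fin (m ∸ 1) → ℕ) →
    (∀ i → 2 ≤ t i) →
    (∀ i j → Data.Fin._<_ i j → t i < t j) →
    (∀ i → t i ≤ (n ∸ 1) / 2) →
    (dC dG : ℕ) → HasDiameter (Circulant n t) dC → HasDiameter (GGPG n t) dG →
    (dC + 1 ≤ dG) × (dG ≤ dC + 2)
theorem4p2 n _ _ _ t _ _ _ dC dG (reachC , x , y , farC) (reachG , p , q , farG) = lower , upper
  where
    open ≤-Reasoning

    lower : dC + 1 ≤ dG
    lower with reachG (inj₁ x) (inj₂ y)
    ... | l , l≤dG , wG with project-u⇝v n t wG
    ...   | k , k<l , wC = begin
      dC + 1  ≡⟨ +-comm dC 1 ⟩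
      suc dC  ≤⟨ s≤s (farC k wC) ⟩
      suc k   ≤⟨ k<l ⟩
      l       ≤⟨ l≤dG ⟩
      dG      ∎

    upper : dG ≤ dC + 2
    upper with reachC (reduce p) (reduce q)
    ... | k , k≤dC , wC with lift n t p q wC
    ...   | l , l≤2+k , wG = begin
      dG      ≤⟨ farG l wG ⟩
      l       ≤⟨ l≤2+k ⟩
      2 + k   ≤⟨ +-monoʳ-≤ 2 k≤dC ⟩
      2 + dC  ≡⟨ +-comm 2 dC ⟩
      dC + 2  ∎
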